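{- Let $x=x_1x_2\cdots x_n$ be a binary string ($n\ge 0$). Run the Binary Counter Turing Machine starting from the configuration in which the tape reads $S$ followed by infinitely many $B$'s, with the head on the $S$ in state $q_l$. Then the number of steps after which the machine is, for the first time, in state $q_l$ with the head on $S$ and the tape reading $S\,x_1x_2\cdots x_n\,1\,B\,B\cdots$ equals $4\,n(1x^R)-2\,w(x1)$.
   Context: The Binary Counter Turing Machine has tape symbols $\{S,0,1,B,T\}$ and states $\{q_l,q_r\}$; a transition $\delta(q,c)=(c',q',D)$ means: in state $q$ reading $c$, write $c'$, go to state $q'$, and move in direction $D\in\{L,R,-\}$. Its rules are: $\delta(q_l,S)=(S,q_r,R)$; $\delta(q_r,1)=(0,q_r,R)$; $\delta(q_r,b)=(1,q_l,L)$ for $b\in\{0,B\}$; $\delta(q_l,b)=(b,q_l,L)$ for $b\in\{0,1\}$; $\delta(q,T)=(T,q,-)$ for $q\in\{q_r,q_l\}$. For a binary string $u$, $u^R$ denotes its reverse, $n(u)$ the integer whose binary representation (most significant bit first) is $u$, and $w(u)$ the number of $1$'s in $u$; $1x^R$ and $x1$ denote concatenations. -}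

module Defs where

open import Data.Nat using (ℕ; zero; suc; _+_; _*_; _<_)
open import Data.Nat.Properties using (_≟_)
open import Data.Bool using (Bool; true; false)
open import Data.List using (List; []; _∷_; foldl; reverse; _++_; length; lookup)
open import Data.Maybe using (Maybe; just; nothing; _>>=_)
open import Data.Fin using (Fin; fromℕ<)
open import Data.Product using (_×_; Σ; _,_)
open import Relation.Nullary using (yes; no; ¬_)
open import Relation.Binary.PropositionalEquality using (_≡_)

data Sym : Set where
  S O I B T : Sym

data State : Set where
  ql qr : State

data Dir : Set where
  L R N : Dir

δ : State → Sym → Maybe (Sym × State × Dir)
δ ql S = just (S , qr , R)
δ qr I = just (O , qr , R)
δ qr O = just (I , ql , L)
δ qr B = just (I , ql , L)
δ ql O = just (O , ql , L)
δ ql I = just (I , ql , L)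
δ qr T = just (T , qr , N)
δ ql T = just (T , ql , N)
δ ql B = nothing
δ qr S = nothing

-- A configuration: state, head position (cell 0 is the leftmost cell), tape contents.
record Config : Set where
  constructor conf
  field
    state : State
    head  : ℕ
    tape  : ℕ → Sym
open Config public

write : (ℕ → Sym) → ℕ → Sym → (ℕ → Sym)
write t p c i with i ≟ p
... | yes _ = c
... | no  _ = t i

move : Dir → ℕ → Maybe ℕ
move L zero    = nothing   -- falling off the left end: machine halts (never happens here)
move L (suc p) = just p
move R p       = just (suc p)
move N p       = just p

step : Config → Maybe Config
step (conf q p t) with δ q (t p)
... | nothing = nothing
... | just (c' , q' , d) with move d p
...   | nothing = nothing
...   | just p' = just (conf q' p' (write t p c'))

run : ℕ → Config → Maybe Config
run zero    c = just c
run (suc k) c = step c >>= run k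

initTape : ℕ → Sym
initTape zero    = S
initTape (suc _) = B

initConfig : Config
initConfig = conf ql 0 initTape

bitSym : Bool → Sym
bitSym false = O
bitSym true  = I

targetTape : List Bool → ℕ → Sym
targetTape x zero = S
targetTape x (suc i) = go (x ++ true ∷ []) i
  where
  go : List Bool → ℕ → Sym
  go []       _       = B
  go (b ∷ _)  zero    = bitSym b
  go (_ ∷ bs) (suc j) = go bs j

IsTarget : List Bool → Config → Set
IsTarget x c = (state c ≡ ql) × (head c ≡ 0) × (∀ i → tape c i ≡ targetTape x i)

ReachedAt : List Bool → ℕ → Set
ReachedAt x k = Σ Config λ c → (run k initConfig ≡ just c) × IsTarget x c

FirstHit : List Bool → ℕ → Set
FirstHit x k = ReachedAt x k × (∀ j → j < k → ¬ ReachedAt x j)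

bit : Bool → ℕ
bit false = 0
bit true  = 1

val : List Bool → ℕ
val = foldl (λ acc b → 2 * acc + bit b) 0

weight : List Bool → ℕ
weight []       = 0
weight (b ∷ bs) = bit b + weight bs

-- The machine is a binary counter: the tape S b₀ b₁ … B B … holds a number least significant
-- bit first, and each round trip of the head from S back to S adds one to it. Incrementing a
-- number with exactly t trailing ones takes 2t + 2 steps (one step off S, t + 1 steps carrying
-- to the right, t steps back) and changes its weight by 1 − t, so the step count is
-- 4 − 2·(change of weight); summed over the first m increments it is 4m − 2 w(binary m).
-- In between, every configuration is in q_r or off cell 0, and at earlier returns to S the tape
-- displays a smaller number, so the tape S x 1 B …, which displays m = n(1xᴿ), first appears
-- after exactly m increments.
module Submission where

open import Defs
open import Data.Nat using (ℕ; zero; suc; _+_; _*_; _∸_; _≤_; _<_; z≤n; s≤s; z<s; _<?_)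
open import Data.Nat.Properties
open import Data.Nat.Tactic.RingSolver using (solve-∀)
open import Data.Bool using (Bool; true; false)
open import Data.List using (List; []; _∷_; _++_; _∷ʳ_; reverse; drop)
open import Data.List.Properties using (reverse-++; unfold-reverse; foldl-∷ʳ; ++-conicalʳ)
open import Data.Maybe using (just)
open import Data.Product using (Σ; _×_; _,_)
open import Data.Sum using (_⊎_; inj₁; inj₂)
open import Relation.Nullary using (¬_; yes; no; contradiction)
open import Relation.Binary.PropositionalEquality

write-same : ∀ t p c → write t p c p ≡ c
write-same t p c with p ≟ p
... | yes _ = refl
... | no p≢p = contradiction refl p≢p

write-other : ∀ t p c {i} → i ≢ p → write t p c i ≡ t i
write-other t p c {i} i≢p with i ≟ p
... | yes i≡p = contradiction i≡p i≢p
... | no _ = refl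

write-self : ∀ t p → write t p (t p) ≗ t
write-self t p i with i ≟ p
... | yes refl = refl
... | no _ = refl

step-just : ∀ {q} p t {c q′ d p′} → δ q (t p) ≡ just (c , q′ , d) → move d p ≡ just p′ →
            step (conf q p t) ≡ just (conf q′ p′ (write t p c))
step-just p t δ≡ move≡ rewrite δ≡ | move≡ = refl

run-suc : ∀ c {c′} k → step c ≡ just c′ → run (suc k) c ≡ run k c′
run-suc c k step≡ rewrite step≡ = refl

run-+ : ∀ a b {c c′} → run a c ≡ just c′ → run (a + b) c ≡ run b c′
run-+ zero b refl = refl
run-+ (suc a) b {c = c} run≡ with step c
... | just c″ = run-+ a b run≡

HoldsAfter : (Config → Set) → ℕ → Config → Set
HoldsAfter P k c = Σ Config λ c′ → (run k c ≡ just c′) × P c′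

HoldsBefore : (Config → Set) → ℕ → Config → Set
HoldsBefore P k c = ∀ j → j < k → HoldsAfter P j c

FirstTime : (Config → Set) → ℕ → Config → Set
FirstTime P k c = HoldsAfter P k c × (∀ j → j < k → ¬ HoldsAfter P j c)

variable
  P Q : Config → Set

holdsAfter-+ : ∀ a k {c c′} → run a c ≡ just c′ → HoldsAfter P k c′ → HoldsAfter P (a + k) c
holdsAfter-+ a k run≡ (c″ , run≡′ , p) = c″ , trans (run-+ a k run≡) run≡′ , p

holdsBefore-map : ∀ {k c} → (∀ {c′} → P c′ → Q c′) → HoldsBefore P k c → HoldsBefore Q k c
holdsBefore-map f before j j<k with before j j<k
... | c′ , run≡ , p = c′ , run≡ , f p

holdsBefore-+ : ∀ a b {c c′} → run a c ≡ just c′ →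
                HoldsBefore P a c → HoldsBefore P b c′ → HoldsBefore P (a + b) c
holdsBefore-+ {P = P} a b {c} run≡ before₁ before₂ j j<a+b with j <? a
... | yes j<a = before₁ j j<a
... | no j≮a = subst (λ i → HoldsAfter P i c) a+k≡j (holdsAfter-+ a (j ∸ a) run≡ (before₂ (j ∸ a) k<b))
  where
  a+k≡j : a + (j ∸ a) ≡ j
  a+k≡j = m+[n∸m]≡n (≮⇒≥ j≮a)
  k<b : j ∸ a < b
  k<b = +-cancelˡ-< a (j ∸ a) b (subst (_< a + b) (sym a+k≡j) j<a+b)

holdsBefore-step : ∀ {c k c′} → step c ≡ just c′ → P c → HoldsBefore P k c′ → HoldsBefore P (suc k) c
holdsBefore-step {c = c} step≡ p =
  holdsBefore-+ 1 _ (run-suc c 0 step≡) λ { zero _ → c , refl , p ; (suc _) (s≤s ()) }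

holdsBefore-excludes : ∀ {k c} → (∀ {c′} → P c′ → ¬ Q c′) →
                       HoldsBefore P k c → ∀ j → j < k → ¬ HoldsAfter Q j c
holdsBefore-excludes excl before j j<k (c′ , run≡ , q) with before j j<k
... | c″ , run≡′ , p with trans (sym run≡) run≡′
... | refl = excl p q

firstTime-map : ∀ {k c} → (∀ {c′} → P c′ → Q c′) → (∀ {c′} → Q c′ → P c′) →
                FirstTime P k c → FirstTime Q k c
firstTime-map f g ((c′ , run≡ , p) , never) =
  (c′ , run≡ , f p) , λ j j<k (c″ , run≡′ , q) → never j j<k (c″ , run≡′ , g q)

cells : List Bool → ℕ → Sym
cells [] _ = B
cells (b ∷ _) zero = bitSym b
cells (_ ∷ bs) (suc i) = cells bs i

tapeOf : List Bool → ℕ → Sym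
tapeOf bs zero = S
tapeOf bs (suc i) = cells bs i

Represents : (ℕ → Sym) → List Bool → Set
Represents t bs = t ≗ tapeOf bs

-- A record rather than a function type, so that t, p and bs are inferable from a proof.
record Shows (t : ℕ → Sym) (p : ℕ) (bs : List Bool) : Set where
  constructor mkShows
  field shows-at : ∀ i → t (p + i) ≡ cells bs i
open Shows

module _ {t : ℕ → Sym} {p : ℕ} where

  shows-here : ∀ {bs} → Shows t p bs → t p ≡ cells bs 0
  shows-here shows = trans (cong t (sym (+-identityʳ p))) (shows-at shows 0)

  shows-∷ : ∀ {b bs} → t p ≡ bitSym b → Shows t (suc p) bs → Shows t p (b ∷ bs)
  shows-∷ here rest = mkShows λ where
    zero → trans (cong t (+-identityʳ p)) here
    (suc i) → trans (cong t (+-suc p i)) (shows-at rest i)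

  shows-drop : ∀ {bs} → Shows t p bs → Shows t (suc p) (drop 1 bs)
  shows-drop {[]} shows = mkShows λ i → trans (cong t (sym (+-suc p i))) (shows-at shows (suc i))
  shows-drop {_ ∷ _} shows = mkShows λ i → trans (cong t (sym (+-suc p i))) (shows-at shows (suc i))

  shows-write : ∀ {q c bs} → q < p → Shows t p bs → Shows (write t q c) p bs
  shows-write q<p shows = mkShows λ i →
    trans (write-other t _ _ (>⇒≢ (<-≤-trans q<p (m≤m+n p i)))) (shows-at shows i)

IsBit : Sym → Set
IsBit s = s ≡ O ⊎ s ≡ I

δ-ql-bit : ∀ {s} → IsBit s → δ ql s ≡ just (s , ql , L)
δ-ql-bit (inj₁ refl) = refl
δ-ql-bit (inj₂ refl) = refl

Busy : Config → Set
Busy c = state c ≡ qr ⊎ head c ≢ 0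

sweepLeft : ∀ p t → (∀ i → 0 < i → i ≤ p → IsBit (t i)) →
  Σ (ℕ → Sym) λ t′ → t′ ≗ t
    × run p (conf ql p t) ≡ just (conf ql 0 t′)
    × HoldsBefore Busy p (conf ql p t)
sweepLeft zero t _ = t , (λ _ → refl) , refl , λ _ ()
sweepLeft (suc p) t bits with sweepLeft p (write t (suc p) (t (suc p))) bits′
  where
  bits′ : ∀ i → 0 < i → i ≤ p → IsBit (write t (suc p) (t (suc p)) i)
  bits′ i 0<i i≤p = subst IsBit (sym (write-self t (suc p) i)) (bits i 0<i (m≤n⇒m≤1+n i≤p))
... | t′ , t′≗ , run≡ , busy =
  t′ , (λ i → trans (t′≗ i) (write-self t (suc p) i)) ,
  trans (run-suc (conf ql (suc p) t) p step≡) run≡ , holdsBefore-step step≡ (inj₂ λ ()) busy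
  where
  step≡ : step (conf ql (suc p) t) ≡ just (conf ql p (write t (suc p) (t (suc p))))
  step≡ = step-just (suc p) t (δ-ql-bit (bits (suc p) z<s ≤-refl)) refl

increment : List Bool → List Bool
increment [] = true ∷ []
increment (false ∷ bs) = true ∷ bs
increment (true ∷ bs) = false ∷ increment bs

trailingOnes : List Bool → ℕ
trailingOnes [] = 0
trailingOnes (false ∷ _) = 0
trailingOnes (true ∷ bs) = suc (trailingOnes bs)

increment-bits : ∀ bs k → k ≤ trailingOnes bs → IsBit (cells (increment bs) k)
increment-bits [] zero _ = inj₂ refl
increment-bits (false ∷ bs) zero _ = inj₂ refl
increment-bits (true ∷ bs) zero _ = inj₁ refl
increment-bits (true ∷ bs) (suc k) (s≤s k≤n) = increment-bits bs k k≤n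

Carries : ℕ → List Bool → ℕ → (ℕ → Sym) → Set
Carries n bs p t = Σ (ℕ → Sym) λ t′ →
    run (suc n) (conf qr (suc p) t) ≡ just (conf ql (p + n) t′)
  × Shows t′ (suc p) bs
  × (∀ i → i ≤ p → t′ i ≡ t i)
  × HoldsBefore (λ c → state c ≡ qr) (suc n) (conf qr (suc p) t)

carryRight-stop : ∀ rest p t → δ qr (t (suc p)) ≡ just (I , ql , L) → Shows t (suc (suc p)) rest →
                  Carries 0 (true ∷ rest) p t
carryRight-stop rest p t δ≡ shows =
  write t (suc p) I ,
  trans (run-suc (conf qr (suc p) t) 0 step≡)
        (cong (λ k → just (conf ql k (write t (suc p) I))) (sym (+-identityʳ p))) ,
  shows-∷ (write-same t (suc p) I) (shows-write (n<1+n (suc p)) shows) ,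
  (λ i i≤p → write-other t (suc p) I (<⇒≢ (s≤s i≤p))) ,
  holdsBefore-step step≡ refl λ _ ()
  where
  step≡ : step (conf qr (suc p) t) ≡ just (conf ql p (write t (suc p) I))
  step≡ = step-just (suc p) t δ≡ refl

carryRight : ∀ bs p t → Shows t (suc p) bs → Carries (trailingOnes bs) (increment bs) p t
carryRight [] p t shows = carryRight-stop [] p t (cong (δ qr) (shows-here shows)) (shows-drop shows)
carryRight (false ∷ bs) p t shows =
  carryRight-stop bs p t (cong (δ qr) (shows-here shows)) (shows-drop shows)
carryRight (true ∷ bs) p t shows
  with carryRight bs (suc p) (write t (suc p) O) (shows-write (n<1+n (suc p)) (shows-drop shows))
... | t′ , run≡ , shows′ , low , inQr =
  t′ ,
  trans (run-suc (conf qr (suc p) t) (suc (trailingOnes bs)) step≡)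
        (trans run≡ (cong (λ k → just (conf ql k t′)) (sym (+-suc p (trailingOnes bs))))) ,
  shows-∷ (trans (low (suc p) ≤-refl) (write-same t (suc p) O)) shows′ ,
  (λ i i≤p → trans (low i (m≤n⇒m≤1+n i≤p)) (write-other t (suc p) O (<⇒≢ (s≤s i≤p)))) ,
  holdsBefore-step step≡ refl inQr
  where
  step≡ : step (conf qr (suc p) t) ≡ just (conf qr (suc (suc p)) (write t (suc p) O))
  step≡ = step-just (suc p) t (cong (δ qr) (shows-here shows)) refl

incrementSteps : List Bool → ℕ
incrementSteps bs = suc (suc (trailingOnes bs) + trailingOnes bs)

run-increment : ∀ bs t → Represents t bs → Σ (ℕ → Sym) λ t′ →
    run (incrementSteps bs) (conf ql 0 t) ≡ just (conf ql 0 t′)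
  × Represents t′ (increment bs)
  × HoldsBefore (λ c → Busy c ⊎ Represents (tape c) bs) (incrementSteps bs) (conf ql 0 t)
run-increment bs t rep
  with carryRight bs 0 (write t 0 S) (mkShows λ i → trans (write-other t 0 S λ ()) (rep (suc i)))
... | t₁ , carry , shows₁ , low₁ , inQr
  with sweepLeft (trailingOnes bs) t₁
         (λ { (suc k) _ k<n → subst IsBit (sym (shows-at shows₁ k)) (increment-bits bs k (<⇒≤ k<n)) })
... | t₂ , t₂≗t₁ , sweep , busy =
  t₂ , trans (run-suc (conf ql 0 t) (suc r + r) first) run≡ , rep′ , holdsBefore-step first (inj₂ rep) during
  where
  r : ℕ
  r = trailingOnes bs
  started : Config
  started = conf qr 1 (write t 0 S)
  run≡ : run (suc r + r) started ≡ just (conf ql 0 t₂)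
  run≡ = trans (run-+ (suc r) r {started} carry) sweep
  during : HoldsBefore (λ c → Busy c ⊎ Represents (tape c) bs) (suc r + r) started
  during = holdsBefore-+ (suc r) r {started} carry
             (holdsBefore-map (λ s → inj₁ (inj₁ s)) inQr) (holdsBefore-map inj₁ busy)
  first : step (conf ql 0 t) ≡ just (conf qr 1 (write t 0 S))
  first = step-just 0 t (cong (δ ql) (rep 0)) refl
  rep′ : Represents t₂ (increment bs)
  rep′ zero = trans (t₂≗t₁ 0) (trans (low₁ 0 z≤n) (write-same t 0 S))
  rep′ (suc k) = trans (t₂≗t₁ (suc k)) (shows-at shows₁ k)

binary : ℕ → List Bool
binary zero = []
binary (suc n) = increment (binary n)

countingSteps : ℕ → ℕ
countingSteps zero = 0
countingSteps (suc n) = countingSteps n + incrementSteps (binary n)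

Counting : ℕ → Config → Set
Counting n c = Busy c ⊎ Σ ℕ λ m → m < n × Represents (tape c) (binary m)

run-counting : ∀ n → Σ (ℕ → Sym) λ t →
    run (countingSteps n) initConfig ≡ just (conf ql 0 t)
  × Represents t (binary n)
  × HoldsBefore (Counting n) (countingSteps n) initConfig
run-counting zero = initTape , refl , (λ { zero → refl ; (suc _) → refl }) , λ _ ()
run-counting (suc n) with run-counting n
... | t , run≡ , rep , before with run-increment (binary n) t rep
... | t′ , run≡′ , rep′ , during =
  t′ , trans (run-+ (countingSteps n) _ run≡) run≡′ , rep′ ,
  holdsBefore-+ (countingSteps n) _ run≡
    (holdsBefore-map earlier before) (holdsBefore-map current during)
  where
  earlier : ∀ {c} → Counting n c → Counting (suc n) c
  earlier (inj₁ busy) = inj₁ busy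
  earlier (inj₂ (m , m<n , rep)) = inj₂ (m , m<n⇒m<1+n m<n , rep)
  current : ∀ {c} → Busy c ⊎ Represents (tape c) (binary n) → Counting (suc n) c
  current (inj₁ busy) = inj₁ busy
  current (inj₂ rep) = inj₂ (n , ≤-refl , rep)

weight-increment : ∀ bs → trailingOnes bs + weight (increment bs) ≡ suc (weight bs)
weight-increment [] = refl
weight-increment (false ∷ bs) = refl
weight-increment (true ∷ bs) = cong suc (weight-increment bs)

countingSteps-weight : ∀ n → countingSteps n + 2 * weight (binary n) ≡ 4 * n
countingSteps-weight zero = refl
countingSteps-weight (suc n) = begin
    countingSteps n + incrementSteps bs + 2 * weight (increment bs)
  ≡⟨ regroup (countingSteps n) (trailingOnes bs) (weight (increment bs)) ⟩
    2 + (countingSteps n + 2 * (trailingOnes bs + weight (increment bs)))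
  ≡⟨ cong (λ w → 2 + (countingSteps n + 2 * w)) (weight-increment bs) ⟩
    2 + (countingSteps n + 2 * suc (weight bs))
  ≡⟨ shift (countingSteps n) (weight bs) ⟩
    4 + (countingSteps n + 2 * weight bs)
  ≡⟨ cong (4 +_) (countingSteps-weight n) ⟩
    4 + 4 * n
  ≡⟨ sym (*-suc 4 n) ⟩
    4 * suc n ∎
  where
  open ≡-Reasoning
  bs = binary n
  regroup : ∀ a t w → a + suc (suc t + t) + 2 * w ≡ 2 + (a + 2 * (t + w))
  regroup = solve-∀
  shift : ∀ a w → 2 + (a + 2 * suc w) ≡ 4 + (a + 2 * w)
  shift = solve-∀

valueLSB : List Bool → ℕ
valueLSB [] = 0
valueLSB (b ∷ bs) = bit b + 2 * valueLSB bs

val-reverse : ∀ bs → val (reverse bs) ≡ valueLSB bs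
val-reverse [] = refl
val-reverse (b ∷ bs) = begin
    val (reverse (b ∷ bs))          ≡⟨ cong val (unfold-reverse b bs) ⟩
    val (reverse bs ∷ʳ b)           ≡⟨ foldl-∷ʳ _ 0 b (reverse bs) ⟩
    2 * val (reverse bs) + bit b    ≡⟨ cong (λ v → 2 * v + bit b) (val-reverse bs) ⟩
    2 * valueLSB bs + bit b         ≡⟨ +-comm (2 * valueLSB bs) (bit b) ⟩
    valueLSB (b ∷ bs)               ∎
  where open ≡-Reasoning

valueLSB-increment : ∀ bs → valueLSB (increment bs) ≡ suc (valueLSB bs)
valueLSB-increment [] = refl
valueLSB-increment (false ∷ bs) = refl
valueLSB-increment (true ∷ bs) = trans (cong (2 *_) (valueLSB-increment bs)) (*-suc 2 (valueLSB bs))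

valueLSB-binary : ∀ n → valueLSB (binary n) ≡ n
valueLSB-binary zero = refl
valueLSB-binary (suc n) = trans (valueLSB-increment (binary n)) (cong suc (valueLSB-binary n))

binary-injective : ∀ {m n} → binary m ≡ binary n → m ≡ n
binary-injective {m} {n} eq =
  trans (sym (valueLSB-binary m)) (trans (cong valueLSB eq) (valueLSB-binary n))

binary-double : ∀ n → binary (2 * suc n) ≡ false ∷ binary (suc n)
binary-double zero = refl
binary-double (suc n) =
  trans (cong binary (*-suc 2 (suc n))) (cong (λ bs → increment (increment bs)) (binary-double n))

binary-cons : ∀ b n → binary (bit b + 2 * suc n) ≡ b ∷ binary (suc n)
binary-cons false n = binary-double n
binary-cons true n = cong increment (binary-double n)

binary-valueLSB : ∀ x → binary (valueLSB (x ++ true ∷ [])) ≡ x ++ true ∷ []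
binary-valueLSB [] = refl
binary-valueLSB (b ∷ x) with valueLSB (x ++ true ∷ []) | binary-valueLSB x
... | zero | eq = contradiction (++-conicalʳ x (true ∷ []) (sym eq)) λ ()
... | suc n | eq = trans (binary-cons b n) (cong (b ∷_) eq)

bitSym-injective : ∀ {b b′} → bitSym b ≡ bitSym b′ → b ≡ b′
bitSym-injective {false} {false} _ = refl
bitSym-injective {true} {true} _ = refl

cells-injective : ∀ xs ys → cells xs ≗ cells ys → xs ≡ ys
cells-injective [] [] _ = refl
cells-injective [] (false ∷ _) eq with () ← eq 0
cells-injective [] (true ∷ _) eq with () ← eq 0
cells-injective (false ∷ _) [] eq with () ← eq 0
cells-injective (true ∷ _) [] eq with () ← eq 0
cells-injective (b ∷ xs) (b′ ∷ ys) eq =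
  cong₂ _∷_ (bitSym-injective (eq 0)) (cells-injective xs ys (λ i → eq (suc i)))

represents-injective : ∀ {t xs ys} → Represents t xs → Represents t ys → xs ≡ ys
represents-injective {xs = xs} {ys} rep rep′ =
  cells-injective xs ys (λ i → trans (sym (rep (suc i))) (rep′ (suc i)))

tapeOf-targetTape : ∀ x → tapeOf (x ++ true ∷ []) ≗ targetTape x
tapeOf-targetTape x zero = refl
tapeOf-targetTape [] (suc zero) = refl
tapeOf-targetTape [] (suc (suc i)) = refl
tapeOf-targetTape (b ∷ x) (suc zero) = refl
tapeOf-targetTape (b ∷ x) (suc (suc i)) = tapeOf-targetTape x (suc i)

Displays : List Bool → Config → Set
Displays bs c = state c ≡ ql × head c ≡ 0 × Represents (tape c) bs

counting-excludes : ∀ n {c} → Counting n c → ¬ Displays (binary n) c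
counting-excludes n (inj₁ (inj₁ qr≡)) (ql≡ , _) = contradiction (trans (sym qr≡) ql≡) λ ()
counting-excludes n (inj₁ (inj₂ head≢0)) (_ , head≡0 , _) = head≢0 head≡0
counting-excludes n (inj₂ (m , m<n , rep)) (_ , _ , rep′) =
  <⇒≢ m<n (binary-injective (represents-injective rep rep′))

counting-firstTime : ∀ n → FirstTime (Displays (binary n)) (countingSteps n) initConfig
counting-firstTime n with run-counting n
... | t , run≡ , rep , before =
  (conf ql 0 t , run≡ , refl , refl , rep) , holdsBefore-excludes (counting-excludes n) before

mainTheorem4 : (x : List Bool) →
    FirstHit x (4 * val (true ∷ reverse x) ∸ 2 * weight (x ++ true ∷ []))
mainTheorem4 x =
  subst (FirstHit x) steps (firstTime-map toTarget fromTarget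
    (subst (λ bs → FirstTime (Displays bs) (countingSteps m) initConfig) binary-m (counting-firstTime m)))
  where
  m = val (true ∷ reverse x)
  m≡value : m ≡ valueLSB (x ++ true ∷ [])
  m≡value = trans (cong val (sym (reverse-++ x (true ∷ [])))) (val-reverse (x ++ true ∷ []))
  binary-m : binary m ≡ x ++ true ∷ []
  binary-m = trans (cong binary m≡value) (binary-valueLSB x)
  steps : countingSteps m ≡ 4 * m ∸ 2 * weight (x ++ true ∷ [])
  steps = trans (sym (m+n∸n≡m (countingSteps m) (2 * weight (binary m))))
                (cong₂ (λ k bs → k ∸ 2 * weight bs) (countingSteps-weight m) binary-m)
  toTarget : ∀ {c} → Displays (x ++ true ∷ []) c → IsTarget x c
  toTarget (s , h , rep) = s , h , λ i → trans (rep i) (tapeOf-targetTape x i)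
  fromTarget : ∀ {c} → IsTarget x c → Displays (x ++ true ∷ []) c
  fromTarget (s , h , tgt) = s , h , λ i → trans (tgt i) (sym (tapeOf-targetTape x i))
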